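{- Let $H=(V,E)$ be an undirected graph with $|V|=n$ and maximum degree at most $\Delta$, and let $G=\mathcal{R}(H)$. If $H$ is $3$-colorable, then $\mathrm{dist}_{\mathrm{DAG}}(G)\le 2n$.
   Context: $\mathrm{dist}_{\mathrm{DAG}}(G)$ is the minimum number of edges whose deletion makes the digraph $G$ acyclic. Fix integers $\Delta\ge1$, $t\ge 1$, $r\ge 2$ and a real $\delta>0$ with $\frac{\delta}{2}(1+r)>t\Delta$. The reduction $\mathcal{R}$: given an undirected graph $H=(V,E)$ with vertices having distinct integer IDs, build the digraph $G$ with vertices $y_{v,i},x_{v,i}$ for $v\in V$, $i\in\{1,2,3\}$; $a_{e,i,\ell},b_{e,i,\ell}$ for $e\in E$, $i\in\{1,2,3\}$, $\ell\in[t]$; and $s_{v,i,j,\ell}$ for $v\in V$, ordered pairs $i\ne j$ in $\{1,2,3\}$, $\ell\in[r]$. Edges: selection edges $y_{v,i}\to x_{v,i}$; for each $e=\{u,v\}$ with $u<v$, each $i$ and $\ell\in[t]$: $x_{u,i}\to a_{e,i,\ell}\to y_{v,i}$ and $x_{v,i}\to b_{e,i,\ell}\to y_{u,i}$; for each $v$, $i\ne j$, $\ell\in[r]$: $x_{v,i}\to s_{v,i,j,\ell}\to y_{v,j}$.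
   Formalization: The constant δ with $\frac{\delta}{2}(1+r)>t\Delta$ ranges over the positive rationals rather than the reals. -}

module Defs where

open import Data.Nat using (ℕ; zero; suc; _+_; _*_; _≤_)
open import Data.Fin using (Fin; _<_)
open import Data.Bool using (Bool; true; false; if_then_else_)
open import Data.List using (List; length)
open import Data.List.Membership.Propositional using (_∈_)
open import Data.Vec.Functional using (foldr)
open import Data.Product using (Σ; ∃; _×_; _,_)
open import Relation.Binary.PropositionalEquality using (_≡_; _≢_)
open import Relation.Nullary using (¬_)

record UGraph (n : ℕ) : Set where
  field
    adj   : Fin n → Fin n → Bool
    sym   : ∀ u v → adj u v ≡ adj v u
    irrefl : ∀ v → adj v v ≡ false
open UGraph public

degree : ∀ {n} → UGraph n → Fin n → ℕ
degree {n} H v = foldr _+_ 0 (λ u → if adj H v u then 1 else 0)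

MaxDegreeAtMost : ∀ {n} → UGraph n → ℕ → Set
MaxDegreeAtMost H Δ = ∀ v → degree H v ≤ Δ

ThreeColorable : ∀ {n} → UGraph n → Set
ThreeColorable {n} H =
  Σ (Fin n → Fin 3) λ c → ∀ u v → adj H u v ≡ true → c u ≢ c v

record Digraph : Set₁ where
  field
    V : Set
    E : V → V → Set
open Digraph public

Arc : Digraph → Set
Arc G = Σ (V G) λ u → Σ (V G) λ w → E G u w

data Walk (G : Digraph) (F : List (Arc G)) : V G → V G → Set where
  []  : ∀ {u} → Walk G F u u
  _∷_ : ∀ {u w z} (e : E G u w) → ¬ ((u , w , e) ∈ F) → Walk G F w z → Walk G F u z

-- G minus F is acyclic: no closed walk of positive length
AcyclicWithout : (G : Digraph) → List (Arc G) → Set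
AcyclicWithout G F =
  ¬ (Σ (V G) λ u → Σ (V G) λ w → Σ (E G u w) λ e →
       (¬ ((u , w , e) ∈ F)) × Walk G F w u)

distDAG≤ : Digraph → ℕ → Set
distDAG≤ G k = Σ (List (Arc G)) λ F → (length F ≤ k) × AcyclicWithout G F

-- The reduction R (parameters t, r; δ and Δ do not affect the construction)

module Reduction {n : ℕ} (H : UGraph n) (t r : ℕ) where

  data RV : Set where
    y x : Fin n → Fin 3 → RV
    a b : (u v : Fin n) → u < v → adj H u v ≡ true → Fin 3 → Fin t → RV
    s : Fin n → (i j : Fin 3) → i ≢ j → Fin r → RV

  data RE : RV → RV → Set where
    sel : ∀ v i → RE (y v i) (x v i)
    xa  : ∀ u v p q i ℓ → RE (x u i) (a u v p q i ℓ)
    ay  : ∀ u v p q i ℓ → RE (a u v p q i ℓ) (y v i)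
    xb  : ∀ u v p q i ℓ → RE (x v i) (b u v p q i ℓ)
    by  : ∀ u v p q i ℓ → RE (b u v p q i ℓ) (y u i)
    xs  : ∀ v i j p ℓ → RE (x v i) (s v i j p ℓ)
    sy  : ∀ v i j p ℓ → RE (s v i j p ℓ) (y v j)

R : ∀ {n} → UGraph n → (t r : ℕ) → Digraph
R H t r = record { V = Reduction.RV H t r ; E = Reduction.RE H t r }

-- Colour H properly by c and delete, for every vertex v, the two selection arcs
-- y_{v,i} → x_{v,i} with i ≠ c v: these are 2n arcs.  What remains is ranked by
-- y_{v,c v} = 3, x_{v,c v} = 2, y_{v,i} = 0 and x_{v,i} = 5 for i ≠ c v, every
-- middle vertex a, b, s sitting one above the y-vertex it points to.  A remaining
-- arc can only fail to go down on a path x_{u,i} → m → y_{w,j} with i = c u and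
-- j = c w; but j = i and w adjacent to u (for a, b) or w = u and j ≠ i (for s),
-- so c u ≠ c w rules this out.  A strictly decreasing rank admits no cycle.
module Submission where

open import Defs hiding (sym)
open import Data.Nat using (ℕ; _≤_; _*_; _+_; suc; _<_; z≤n; s≤s)
open import Data.Integer using (+_)
open import Data.Rational using (ℚ; _/_; 0ℚ; ½) renaming (_<_ to _<ℚ_; _*_ to _*ℚ_)
open import Data.Nat.Properties using (≤-refl; ≤-trans; <⇒≤; <-irrefl; <-≤-trans; n<1+n; ≤-reflexive; *-comm)
open import Data.Fin using (Fin; _≟_)
open import Data.Fin.Patterns using (0F; 1F; 2F)
open import Data.List using (List; []; _∷_; _++_; length; map; concatMap; filter; allFin)
open import Data.List.Properties using (length-++; length-map; length-tabulate)
open import Data.List.Membership.Propositional using (_∈_)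
open import Data.List.Membership.Propositional.Properties
  using (∈-concat⁺′; ∈-map⁺; ∈-filter⁺; ∈-allFin)
open import Data.Product using (_,_)
open import Data.Empty using (⊥-elim)
open import Data.Bool using (true)
open import Relation.Binary.PropositionalEquality using (_≡_; _≢_; refl; sym; trans; cong; cong₂; module ≡-Reasoning)
open import Relation.Nullary using (¬_; yes; no; ¬?)

length-concatMap-const : ∀ {A B : Set} (f : A → List B) {k : ℕ} →
                         (∀ a → length (f a) ≡ k) → ∀ xs → length (concatMap f xs) ≡ length xs * k
length-concatMap-const f hk [] = refl
length-concatMap-const f hk (a ∷ as) =
  trans (length-++ (f a)) (cong₂ _+_ (hk a) (length-concatMap-const f hk as))

module _ (G : Digraph) (F : List (Arc G)) (rank : V G → ℕ)
         (rank-decreases : ∀ {u w} (e : E G u w) → ¬ ((u , w , e) ∈ F) → rank w < rank u) where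

  rank-antitone-along-walk : ∀ {u w} → Walk G F u w → rank w ≤ rank u
  rank-antitone-along-walk []             = ≤-refl
  rank-antitone-along-walk (_∷_ e e∉F ws) =
    ≤-trans (rank-antitone-along-walk ws) (<⇒≤ (rank-decreases e e∉F))

  acyclic-if-rank-decreasing : AcyclicWithout G F
  acyclic-if-rank-decreasing (u , w , e , e∉F , ws) =
    <-irrefl refl (<-≤-trans (rank-decreases e e∉F) (rank-antitone-along-walk ws))

otherColours : Fin 3 → List (Fin 3)
otherColours k = filter (λ i → ¬? (i ≟ k)) (allFin 3)

length-otherColours : ∀ k → length (otherColours k) ≡ 2
length-otherColours 0F = refl
length-otherColours 1F = refl
length-otherColours 2F = refl

∈-otherColours : ∀ {i k} → i ≢ k → i ∈ otherColours k
∈-otherColours {i} i≢k = ∈-filter⁺ (λ j → ¬? (j ≟ _)) (∈-allFin i) i≢k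

module ColouringDeletion {n : ℕ} (H : UGraph n) (t r : ℕ) (c : Fin n → Fin 3)
                         (proper : ∀ u v → adj H u v ≡ true → c u ≢ c v) where
  open Reduction H t r

  selection : Fin n → Fin 3 → Arc (R H t r)
  selection v i = (y v i , x v i , sel v i)

  unselected : Fin n → List (Arc (R H t r))
  unselected v = map (selection v) (otherColours (c v))

  deleted : List (Arc (R H t r))
  deleted = concatMap unselected (allFin n)

  length-deleted : length deleted ≡ 2 * n
  length-deleted = begin
    length deleted         ≡⟨ length-concatMap-const unselected length-unselected (allFin n) ⟩
    length (allFin n) * 2  ≡⟨ cong (_* 2) (length-tabulate {n = n} (λ v → v)) ⟩
    n * 2                  ≡⟨ *-comm n 2 ⟩
    2 * n                  ∎
    where
    open ≡-Reasoning
    length-unselected : ∀ v → length (unselected v) ≡ 2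
    length-unselected v = trans (length-map (selection v) (otherColours (c v))) (length-otherColours (c v))

  unselected-deleted : ∀ v i → i ≢ c v → selection v i ∈ deleted
  unselected-deleted v i i≢cv =
    ∈-concat⁺′ (∈-map⁺ (selection v) (∈-otherColours i≢cv)) (∈-map⁺ _ (∈-allFin v))

  rankY : Fin n → Fin 3 → ℕ
  rankY v i with i ≟ c v
  ... | yes _ = 3
  ... | no  _ = 0

  rankX : Fin n → Fin 3 → ℕ
  rankX v i with i ≟ c v
  ... | yes _ = 2
  ... | no  _ = 5

  rank : RV → ℕ
  rank (y v i)         = rankY v i
  rank (x v i)         = rankX v i
  rank (a u v _ _ i _) = suc (rankY v i)
  rank (b u v _ _ i _) = suc (rankY u i)
  rank (s v _ j _ _)   = suc (rankY v j)

  rankY≤3 : ∀ v i → rankY v i ≤ 3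
  rankY≤3 v i with i ≟ c v
  ... | yes _ = ≤-refl
  ... | no  _ = z≤n

  x-above-middle : ∀ u w i j → (i ≡ c u → j ≢ c w) → suc (rankY w j) < rankX u i
  x-above-middle u w i j h with i ≟ c u
  ... | no  _   = s≤s (s≤s (rankY≤3 w j))
  ... | yes i≡cu with j ≟ c w
  ...   | yes j≡cw = ⊥-elim (h i≡cu j≡cw)
  ...   | no  _    = s≤s (s≤s z≤n)

  rank-decreases : ∀ {u w} (e : RE u w) → ¬ ((u , w , e) ∈ deleted) → rank w < rank u
  rank-decreases (sel v i) e∉ with i ≟ c v
  ... | yes _    = ≤-refl
  ... | no i≢cv  = ⊥-elim (e∉ (unselected-deleted v i i≢cv))
  rank-decreases (xa u v _ uv i _) _ = x-above-middle u v i i λ i≡cu i≡cv → proper u v uv (trans (sym i≡cu) i≡cv)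
  rank-decreases (xb u v _ uv i _) _ = x-above-middle v u i i λ i≡cv i≡cu → proper u v uv (trans (sym i≡cu) i≡cv)
  rank-decreases (xs v i j i≢j _)  _ = x-above-middle v v i j λ i≡cv j≡cv → i≢j (trans i≡cv (sym j≡cv))
  rank-decreases (ay _ _ _ _ _ _)  _ = n<1+n _
  rank-decreases (by _ _ _ _ _ _)  _ = n<1+n _
  rank-decreases (sy _ _ _ _ _)    _ = n<1+n _

  distDAG≤2n : distDAG≤ (R H t r) (2 * n)
  distDAG≤2n = deleted , ≤-reflexive length-deleted
             , acyclic-if-rank-decreasing (R H t r) deleted rank rank-decreases

lemma6p3 : (Δ t r : ℕ) (δ : ℚ) → 1 ≤ Δ → 1 ≤ t → 2 ≤ r →
           0ℚ <ℚ δ → (+ (t * Δ) / 1) <ℚ ((δ *ℚ ½) *ℚ (+ (1 + r) / 1)) →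
           (n : ℕ) (H : UGraph n) → MaxDegreeAtMost H Δ → ThreeColorable H →
           distDAG≤ (R H t r) (2 * n)
lemma6p3 _ t r _ _ _ _ _ _ n H _ (c , proper) = ColouringDeletion.distDAG≤2n H t r c proper
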